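{- Let $k\in\mathbb{N}$, $E\subseteq W(A)$ and $\vec s=(s_n(x))_{n=0}^\infty\in V^\infty(A)$ be such that $E$ is $k$-large in $\vec s$. Then for every $m\in\mathbb{N}$, $E$ is $(k+m)$-large in $(s_n(x))_{n=m}^\infty$.
   Context: $\mathbb{N}=\{0,1,2,\dots\}$. Fix an increasing sequence $A_0\subseteq A_1\subseteq\cdots$ of nonempty finite sets and let $A=\bigcup_nA_n$. $W(A)$ is the set of finite words over $A$ (including the empty word); words are concatenated by juxtaposition. Fix a symbol $x\notin A$. A variable word is a finite word over $A\cup\{x\}$ containing $x$ at least once; $V(A)$ is the set of variable words and $V^\infty(A)$ the set of infinite sequences of variable words. For $s(x)\in V(A)$ and $a\in A\cup\{x\}$, $s(a)$ replaces every occurrence of $x$ by $a$. For variable words $(s_n(x))_{n=p}^q$ and nonempty $B_p,\dots,B_q\subseteq A$, $\langle(s_n(x))_{n=p}^q\parallel(B_n)_{n=p}^q\rangle_c$ is the set of all words $s_{l_0}(a_0)\cdots s_{l_j}(a_j)$ with $j\ge0$, $p\le l_0<\dots<l_j\le q$, $a_i\in B_{l_i}$, and $\langle\cdot\rangle_v=V(A)\cap\langle(s_n(x))_{n=p}^q\parallel(B_n\cup\{x\})_{n=p}^q\rangle_c$. For infinite $\vec s=(s_n(x))_{n=0}^\infty$, $\langle\vec s\parallel(B_n)_{n=0}^\infty\rangle_c=\bigcup_m\langle(s_n(x))_{n=0}^m\parallel(B_n)_{n=0}^m\rangle_c$. For $j\in\mathbb{N}$, a finite sequence $(t_n(x))_{n=0}^l$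 is an extracted $j$-block subsequence of $\vec s$ if there are $0=m_0<\dots<m_{l+1}$ with $t_i(x)\in\langle(s_n(x))_{n=m_i}^{m_{i+1}-1}\parallel(A_{j+n})_{n=m_i}^{m_{i+1}-1}\rangle_v$ for $0\le i\le l$; an infinite sequence is an extracted $j$-block subsequence if all its finite initial segments are. $E\subseteq W(A)$ is $j$-large in $\vec s$ if $E\cap\langle\vec w\parallel(A_{j+n})_{n=0}^\infty\rangle_c\neq\emptyset$ for every infinite extracted $j$-block subsequence $\vec w$ of $\vec s$. A tail $(s_n(x))_{n=m}^\infty$ is regarded as the sequence $(s_{m+n}(x))_{n=0}^\infty$. -}

module Defs where

open import Data.Nat using (ℕ; zero; suc; _+_; _∸_; _≤_; _<_)
open import Data.List using (List; []; _∷_; _++_; map)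
open import Data.List.Membership.Propositional using (_∈_)
open import Data.List.Relation.Unary.All using (All)
open import Data.Maybe using (Maybe; just; nothing; fromMaybe)
open import Data.Product using (Σ; ∃; _×_; _,_)
open import Data.Sum using (_⊎_)
open import Relation.Binary.PropositionalEquality using (_≡_; _≢_)

-- The alphabet data: an increasing sequence A₀ ⊆ A₁ ⊆ ⋯ of nonempty finite
-- sets of letters (each Aₙ given as a finite list); A = ⋃ₙ Aₙ.
record Alphabet : Set₁ where
  field
    Letter   : Set
    Aₙ       : ℕ → List Letter
    nonempty : ∀ n → Aₙ n ≢ []
    incr     : ∀ n {a} → a ∈ Aₙ n → a ∈ Aₙ (suc n)

module _ (𝒜 : Alphabet) where
  open Alphabet 𝒜

  InA : Letter → Set
  InA a = ∃ λ n → a ∈ Aₙ n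

  IsWord : List Letter → Set
  IsWord w = All InA w

  -- Words over A ∪ {x}: the variable symbol x is represented by 'nothing'.
  IsVarWord : List (Maybe Letter) → Set
  IsVarWord w = (nothing ∈ w) × All (λ c → (c ≡ nothing) ⊎ (Σ Letter λ b → (c ≡ just b) × InA b)) w

  subst : Maybe Letter → List (Maybe Letter) → List (Maybe Letter)
  subst a w = map (λ c → just' c) w
    where
    just' : Maybe Letter → Maybe Letter
    just' (just b) = just b
    just' nothing  = a

  -- Comb s B p q w :  w ∈ { s_{l₀}(a₀)⋯s_{lⱼ}(aⱼ) : j ≥ 0, p ≤ l₀ < ⋯ < lⱼ ≤ q, aᵢ ∈ B_{lᵢ} }
  -- where B n is a predicate on A ∪ {x} (letters 'just b', x = 'nothing').
  data Comb (s : ℕ → List (Maybe Letter)) (B : ℕ → Maybe Letter → Set)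
            : ℕ → ℕ → List (Maybe Letter) → Set where
    single : ∀ {p q l a} → p ≤ l → l ≤ q → B l a → Comb s B p q (subst a (s l))
    cons   : ∀ {p q l a w} → p ≤ l → B l a → Comb s B (suc l) q w
           → Comb s B p q (subst a (s l) ++ w)

  LetA : ℕ → ℕ → Maybe Letter → Set
  LetA j n c = Σ Letter λ b → (c ≡ just b) × (b ∈ Aₙ (j + n))

  LetAx : ℕ → ℕ → Maybe Letter → Set
  LetAx j n c = (c ≡ nothing) ⊎ LetA j n c

  InV : (s : ℕ → List (Maybe Letter)) → ℕ → ℕ → ℕ → List (Maybe Letter) → Set
  InV s j p q t = IsVarWord t × Comb s (LetAx j) p q t

  InCInf : (s : ℕ → List (Maybe Letter)) → ℕ → List Letter → Set
  InCInf s j u = ∃ λ m → Comb s (LetA j) 0 m (map just u)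

  -- (t_n)_{n=0}^∞ is an (infinite) extracted j-block subsequence of s:
  -- every finite initial segment (t_i)_{i=0}^l is one, i.e. there are
  -- 0 = m₀ < m₁ < ⋯ < m_{l+1} with t_i ∈ ⟨(s_n)_{n=m_i}^{m_{i+1}-1} ∥ (A_{j+n})⟩_v.
  Extracted : ℕ → (s t : ℕ → List (Maybe Letter)) → Set
  Extracted j s t = ∀ l → Σ (ℕ → ℕ) λ m →
      (m 0 ≡ 0)
    × (∀ i → i ≤ l → m i < m (suc i))
    × (∀ i → i ≤ l → InV s j (m i) (m (suc i) ∸ 1) (t i))

  Large : ℕ → (List Letter → Set) → (ℕ → List (Maybe Letter)) → Set
  Large j E s = ∀ (w : ℕ → List (Maybe Letter)) → Extracted j s w →
    Σ (List Letter) λ u → E u × InCInf w j u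

  tail : ℕ → (ℕ → List (Maybe Letter)) → (ℕ → List (Maybe Letter))
  tail m s n = s (m + n)

-- Both the block structure and the alphabet indices only need to be shifted:
-- an extracted (k+m)-block subsequence of the tail from m becomes an extracted
-- k-block subsequence of s by adding m to every block boundary except the first,
-- so that the first block also spans s₀,…,s_{m-1} (none of which need be used),
-- and A_{(k+m)+n} = A_{k+(m+n)}.  Conversely a word of ⟨w ∥ (A_{k+n})⟩_c lies in
-- ⟨w ∥ (A_{k+m+n})⟩_c because the Aₙ increase.
module Submission where

open import Defs
open import Data.Nat using (ℕ; _+_; zero; suc; _≤_; _<_; _∸_; _≤′_; ≤′-reflexive; ≤′-step; z≤n; s≤s)
open import Data.Nat.Properties
open import Data.List using (List)
open import Data.Maybe using (Maybe)
open import Data.Product using (_,_)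
open import Data.Sum using (inj₁; inj₂)
open import Relation.Binary.PropositionalEquality using (_≡_; refl; sym)
  renaming (subst to transport)
open import Data.List.Membership.Propositional using (_∈_)

module _ (𝒜 : Alphabet) where
  open Alphabet 𝒜

  Aₙ-mono : ∀ {i j a} → i ≤ j → a ∈ Aₙ i → a ∈ Aₙ j
  Aₙ-mono i≤j = go (≤⇒≤′ i≤j)
    where
    go : ∀ {i j a} → i ≤′ j → a ∈ Aₙ i → a ∈ Aₙ j
    go (≤′-reflexive refl) a∈ = a∈
    go (≤′-step i≤′j)      a∈ = incr _ (go i≤′j a∈)

  LetA-mono : ∀ {j j′ n c} → j ≤ j′ → LetA 𝒜 j n c → LetA 𝒜 j′ n c
  LetA-mono {n = n} j≤j′ (b , c≡b , b∈) = b , c≡b , Aₙ-mono (+-monoˡ-≤ n j≤j′) b∈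

  LetAx-tail : ∀ k m {n c} → LetAx 𝒜 (k + m) n c → LetAx 𝒜 k (m + n) c
  LetAx-tail k m     (inj₁ c≡x)            = inj₁ c≡x
  LetAx-tail k m {n} (inj₂ (b , c≡b , b∈)) =
    inj₂ (b , c≡b , transport (λ i → b ∈ Aₙ i) (+-assoc k m n) b∈)

  Comb-tail : ∀ {B B′ : ℕ → Maybe Letter → Set} m (s : ℕ → List (Maybe Letter))
    → (∀ {n c} → B n c → B′ (m + n) c)
    → ∀ {p q p′ q′ t} → p′ ≤ m + p → m + q ≤ q′
    → Comb 𝒜 (tail 𝒜 m s) B p q t → Comb 𝒜 s B′ p′ q′ t
  Comb-tail m s f p′≤ ≤q′ (single p≤l l≤q b) =
    single (≤-trans p′≤ (+-monoʳ-≤ m p≤l)) (≤-trans (+-monoʳ-≤ m l≤q) ≤q′) (f b)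
  Comb-tail m s f p′≤ ≤q′ (cons {l = l} p≤l b c) =
    cons (≤-trans p′≤ (+-monoʳ-≤ m p≤l)) (f b)
      (Comb-tail m s f (≤-reflexive (sym (+-suc m l))) ≤q′ c)

  Comb-mono : ∀ {B B′ : ℕ → Maybe Letter → Set} (s : ℕ → List (Maybe Letter))
    → (∀ {n c} → B n c → B′ n c)
    → ∀ {p q t} → Comb 𝒜 s B p q t → Comb 𝒜 s B′ p q t
  Comb-mono s f = Comb-tail 0 s f ≤-refl ≤-refl

  InCInf-mono : ∀ {j j′} (w : ℕ → List (Maybe Letter)) {u}
    → j ≤ j′ → InCInf 𝒜 w j u → InCInf 𝒜 w j′ u
  InCInf-mono w j≤j′ (M , c) = M , Comb-mono w (LetA-mono j≤j′) c

  shiftBoundaries : ℕ → (ℕ → ℕ) → ℕ → ℕ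
  shiftBoundaries m bs zero    = 0
  shiftBoundaries m bs (suc i) = m + bs (suc i)

  Extracted-tail : ∀ k m (s w : ℕ → List (Maybe Letter))
    → Extracted 𝒜 (k + m) (tail 𝒜 m s) w → Extracted 𝒜 k s w
  Extracted-tail k m s w ext l with ext l
  ... | bs , _ , bs-incr , blocks = shiftBoundaries m bs , refl , incr′ , blocks′
    where
    bs′ : ℕ → ℕ
    bs′ = shiftBoundaries m bs

    incr′ : ∀ i → i ≤ l → bs′ i < bs′ (suc i)
    incr′ zero    0≤l = ≤-trans (s≤s z≤n) (≤-trans (bs-incr 0 0≤l) (m≤n+m _ m))
    incr′ (suc i) i<l = +-monoʳ-< m (bs-incr (suc i) i<l)

    start : ∀ i → bs′ i ≤ m + bs i
    start zero    = z≤n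
    start (suc i) = ≤-refl

    end : ∀ i → i ≤ l → m + (bs (suc i) ∸ 1) ≤ bs′ (suc i) ∸ 1
    end i i≤l = ≤-reflexive (sym (+-∸-assoc m (≤-trans (s≤s z≤n) (bs-incr i i≤l))))

    blocks′ : ∀ i → i ≤ l → InV 𝒜 s k (bs′ i) (bs′ (suc i) ∸ 1) (w i)
    blocks′ i i≤l with blocks i i≤l
    ... | var , c = var , Comb-tail m s (LetAx-tail k m) (start i) (end i i≤l) c

lemma30 : (𝒜 : Alphabet) (k : ℕ)
    (E : List (Alphabet.Letter 𝒜) → Set)
    → (∀ w → E w → IsWord 𝒜 w)
    → (s : ℕ → List (Maybe (Alphabet.Letter 𝒜)))
    → (∀ n → IsVarWord 𝒜 (s n))
    → Large 𝒜 k E s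
    → ∀ m → Large 𝒜 (k + m) E (tail 𝒜 m s)
lemma30 𝒜 k E _ s _ large m w ext with large w (Extracted-tail 𝒜 k m s w ext)
... | u , u∈E , u∈⟨w⟩ = u , u∈E , InCInf-mono 𝒜 w (m≤m+n k m) u∈⟨w⟩
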